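{- For all integers $p\ge1$ and $q,r\ge0$, the two-rooted comb of type I $T_1(p,q,r)$ is PE-inherent.
   Context: Graphs are simple and undirected. A two-rooted graph is a triple $(H,s,t)$ with $H$ a finite graph and $s,t\in V(H)$ not necessarily distinct. For $p,q,r\ge0$ with $p+q+r>0$, $F(p,q,r)$ is the path $(a_1,\dots,a_{p+q+r})$ together with pendant vertices $b_{p+1},\dots,b_{p+q}$, $b_{p+i}$ adjacent to $a_{p+i}$. $T_1(p,q,r)=(F(p,q,r),a_1,a_p)$. A copy of $(\hat H,\hat s,\hat t)$ in a graph $G$ is $(H,s,t)$ with $H$ an induced subgraph of $G$ and an isomorphism $\hat H\to H$ mapping $\hat s\mapsto s$, $\hat t\mapsto t$. An extension of such a copy in $G$ is $(H',s',t')$ with $H'$ an induced subgraph of $G$, $V(H')=V(H)\cup\{s',t'\}$, $s'\ne t'$ not in $V(H)$, $H'-\{s',t'\}=H$, and $s$ (resp. $t$) the unique neighbour of $s'$ (resp. $t'$) in $H'$. A copy is simplicial if it has no extension. Given a simplicial copy $(H,s,t)$ in $G$, a pendant extension (PE) of $G$ with respect to it is any graph obtained from $G$ by adding the minimum number of pendant edges (to new vertices) at $s$ and/or $t$ so that $(H,s,t)$ becomes non-simplicial. A PE-sequence of $(\hat H,\hat s,\hat t)$ is a finite or infinite sequence $(G_i)_{i\ge0}$ with $G_0=\hat H$ where, if $G_i$ contains a simplicial copy of $(\hat H,\hat s,\hat t)$, $G_{i+1}$ is a PE of $G_i$ with respect to some simplicial copy, and otherwise the sequence ends at $G_i$. A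 two-rooted graph is PE-inherent if all of its PE-sequences are infinite. -}

module Defs where

open import Data.Nat using (ℕ; zero; suc; _+_; _≤_; _<_; _<ᵇ_; _≤ᵇ_; _≡ᵇ_; s≤s; z≤n)
open import Data.Nat.Properties using (m≤m+n; ≤-trans)
open import Data.Bool using (Bool; true; false; _∧_; _∨_; not; if_then_else_)
open import Data.Bool.Properties using (∨-comm)
open import Data.Fin using (Fin; zero; suc; toℕ; fromℕ<; splitAt; _↑ˡ_; _≟_)
open import Data.Sum using (_⊎_; inj₁; inj₂)
open import Data.Product using (Σ; ∃; _×_; _,_)
open import Data.Empty using (⊥)
open import Function using (Injective)
open import Relation.Nullary using (¬_; yes; no)
open import Relation.Nullary.Decidable using (⌊_⌋)
open import Relation.Binary.PropositionalEquality using (_≡_; _≢_; refl; sym; cong₂)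

record Graph (n : ℕ) : Set where
  field
    adj     : Fin n → Fin n → Bool
    adj-sym : ∀ x y → adj x y ≡ adj y x
    adj-irr : ∀ x → adj x x ≡ false
open Graph public

private
  ⌊≟⌋-sym : ∀ {n} (x y : Fin n) → ⌊ x ≟ y ⌋ ≡ ⌊ y ≟ x ⌋
  ⌊≟⌋-sym x y with x ≟ y | y ≟ x
  ... | yes _ | yes _ = refl
  ... | no _  | no _  = refl
  ... | yes p | no ¬q with ¬q (sym p)
  ... | ()
  ⌊≟⌋-sym x y | no ¬p | yes q with ¬p (sym q)
  ... | ()

  ⌊≟⌋-refl : ∀ {n} (x : Fin n) → ⌊ x ≟ x ⌋ ≡ true
  ⌊≟⌋-refl x with x ≟ x
  ... | yes _ = refl
  ... | no ¬p with ¬p refl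
  ... | ()

mkSimple : ∀ {n} → (Fin n → Fin n → Bool) → Graph n
mkSimple R = record
  { adj     = λ x y → not ⌊ x ≟ y ⌋ ∧ (R x y ∨ R y x)
  ; adj-sym = λ x y → cong₂ (λ a b → not a ∧ b) (⌊≟⌋-sym x y) (∨-comm (R x y) (R y x))
  ; adj-irr = λ x → irr x
  }
  where
  irr : ∀ x → not ⌊ x ≟ x ⌋ ∧ (R x x ∨ R x x) ≡ false
  irr x rewrite ⌊≟⌋-refl x = refl

-- Two-rooted graphs (H, s, t); s and t need not be distinct.

record TwoRooted : Set where
  field
    size  : ℕ
    graph : Graph size
    sRoot : Fin size
    tRoot : Fin size
open TwoRooted public

-- The comb F(p,q,r).  Vertex a_i (1 ≤ i ≤ p+q+r) is numbered i-1;
-- vertex b_{p+j} (1 ≤ j ≤ q) is numbered (p+q+r) + (j-1).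
-- Edges: a_i a_{i+1}, and b_{p+j} a_{p+j}.

combRel : (p q r : ℕ) → ℕ → ℕ → Bool
combRel p q r x y =
  let L = p + q + r in
  ((x <ᵇ L) ∧ (y <ᵇ L) ∧ (suc x ≡ᵇ y))            -- path edge a_{x+1} a_{x+2}
  ∨ ((L ≤ᵇ x) ∧ (y <ᵇ L) ∧ ((y + L) ≡ᵇ (x + p)))  -- pendant b_{p+j} -- a_{p+j}

combSize : (p q r : ℕ) → ℕ
combSize p q r = p + q + r + q

F : (p q r : ℕ) → Graph (combSize p q r)
F p q r = mkSimple (λ x y → combRel p q r (toℕ x) (toℕ y))

T₁ : (p q r : ℕ) → 1 ≤ p → TwoRooted
T₁ (suc k) q r _ = record
  { size  = combSize (suc k) q r
  ; graph = F (suc k) q r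
  ; sRoot = zero
  ; tRoot = fromℕ< {k} (s≤s k≤)           -- a_p
  }
  where
  k≤ : k ≤ k + q + r + q
  k≤ = ≤-trans (≤-trans (m≤m+n k q) (m≤m+n (k + q) r)) (m≤m+n (k + q + r) q)

record Copy (Ĥ : TwoRooted) {n : ℕ} (G : Graph n) : Set where
  field
    emb     : Fin (size Ĥ) → Fin n
    emb-inj : Injective _≡_ _≡_ emb
    emb-adj : ∀ x y → adj G (emb x) (emb y) ≡ adj (graph Ĥ) x y
open Copy public

copyS : ∀ {Ĥ n} {G : Graph n} → Copy Ĥ G → Fin n
copyS {Ĥ} c = emb c (sRoot Ĥ)

copyT : ∀ {Ĥ n} {G : Graph n} → Copy Ĥ G → Fin n
copyT {Ĥ} c = emb c (tRoot Ĥ)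

-- An extension of the induced subgraph with vertex set (image of f) and
-- roots s, t in G: new distinct vertices s', t' outside the image such that,
-- in the induced subgraph on image ∪ {s', t'}, s is the unique neighbour
-- of s' and t is the unique neighbour of t'.
record Extension {m n : ℕ} (G : Graph n) (f : Fin m → Fin n) (s t : Fin n) : Set where
  field
    s' t'    : Fin n
    s'≢t'    : s' ≢ t'
    s'∉      : ∀ x → f x ≢ s'
    t'∉      : ∀ x → f x ≢ t'
    s'-nbr   : ∀ x → adj G s' (f x) ≡ true → f x ≡ s
    s'-s     : adj G s' s ≡ true
    t'-nbr   : ∀ x → adj G t' (f x) ≡ true → f x ≡ t
    t'-t     : adj G t' t ≡ true
    s't'     : adj G s' t' ≡ false

HasExtension : ∀ {m n} (G : Graph n) (f : Fin m → Fin n) (s t : Fin n) → Set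
HasExtension G f s t = Extension G f s t

Simplicial : ∀ {Ĥ n} (G : Graph n) → Copy Ĥ G → Set
Simplicial G c = ¬ HasExtension G (emb c) (copyS c) (copyT c)

HasSimplicialCopy : (Ĥ : TwoRooted) {n : ℕ} (G : Graph n) → Set
HasSimplicialCopy Ĥ G = Σ (Copy Ĥ G) λ c → Simplicial G c

-- The new graph has
-- vertex set Fin (n + (a + b)); old vertices are  v ↑ˡ (a + b); the new
-- vertex number n + k is adjacent to s if k < a and to t otherwise.

pendRel : ∀ {n} (G : Graph n) (s t : Fin n) (a b : ℕ) →
          Fin (n + (a + b)) → Fin (n + (a + b)) → Bool
pendRel {n} G s t a b x y with splitAt n x | splitAt n y
... | inj₁ u | inj₁ v = adj G u v
... | inj₂ k | inj₁ v = if toℕ k <ᵇ a then ⌊ v ≟ s ⌋ else ⌊ v ≟ t ⌋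
... | inj₁ _ | inj₂ _ = false
... | inj₂ _ | inj₂ _ = false

addPendants : ∀ {n} (G : Graph n) (s t : Fin n) (a b : ℕ) → Graph (n + (a + b))
addPendants G s t a b = mkSimple (pendRel G s t a b)

lift : ∀ {n} (k : ℕ) → Fin n → Fin (n + k)
lift k v = v ↑ˡ k

-- The copy becomes non-simplicial after adding a pendants at s and b at t.
Fixes : ∀ {Ĥ n} (G : Graph n) → Copy Ĥ G → ℕ → ℕ → Set
Fixes {Ĥ} G c a b =
  HasExtension (addPendants G (copyS c) (copyT c) a b)
               (λ x → lift (a + b) (emb c x))
               (lift (a + b) (copyS c)) (lift (a + b) (copyT c))

MinimalFix : ∀ {Ĥ n} (G : Graph n) → Copy Ĥ G → ℕ → ℕ → Set
MinimalFix G c a b = Fixes G c a b × (∀ a' b' → Fixes G c a' b' → a + b ≤ a' + b')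

data PESeq (Ĥ : TwoRooted) : {n : ℕ} → Graph n → Set where
  start : PESeq Ĥ (graph Ĥ)
  step  : ∀ {n} {G : Graph n} → PESeq Ĥ G →
          (c : Copy Ĥ G) → Simplicial G c →
          (a b : ℕ) → MinimalFix G c a b →
          PESeq Ĥ (addPendants G (copyS c) (copyT c) a b)

-- A finite PE-sequence: one that ends, i.e. whose last graph contains no
-- simplicial copy of Ĥ.
FinitePESeq : TwoRooted → Set
FinitePESeq Ĥ = Σ ℕ λ n → Σ (Graph n) λ G → PESeq Ĥ G × ¬ HasSimplicialCopy Ĥ G

PEInherent : TwoRooted → Set
PEInherent Ĥ = ¬ FinitePESeq Ĥ

-- Every graph of a PE-sequence of T₁(p,q,r) contains a copy of T₁(p,q,r) whose s-root has at
-- most one neighbour, and such a copy is simplicial; so no PE-sequence ends.  The invariant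
-- survives a pendant extension with respect to a simplicial copy c, whose resulting extension
-- (s', t') cannot consist of old vertices only.  If s' is new, sliding c one step along the path
-- s', a₁, a₂, … (with t' as the first tooth) gives a copy rooted at the pendant vertex s'.  If t'
-- is new and p = 1 or q = r = 0, an automorphism exchanging the roots reduces to that case.
-- Otherwise a₁ (adjacent to a₂ and to the old vertex s') and a_p (an interior spine vertex) both
-- have two neighbours, so neither is the root of the old invariant copy, which therefore gains no
-- new neighbours.

module Submission where

open import Defs
open import Data.Nat using (ℕ; zero; suc; _+_; _≤_; _<_; _<ᵇ_; _≤ᵇ_; _≡ᵇ_; s≤s; z≤n)
open import Data.Nat.Properties
  using (<ᵇ⇒<; <⇒<ᵇ; ≤ᵇ⇒≤; ≤⇒≤ᵇ; ≡ᵇ⇒≡; ≡⇒≡ᵇ; suc-injective; ≤-refl; ≤-pred; m≤n⇒m≤1+n; <-irrefl;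
         <-trans; <-≤-trans; ≤∧≢⇒<; <⇒≱; <⇒≢; 1+n≢n; n<1+n; m≤m+n; m<m+n; m+1+n≢m; m+1+n≰m;
         +-comm; +-suc; +-identityʳ; +-cancelˡ-≡; +-cancelʳ-≡; +-cancelˡ-<; m+[n∸m]≡n)
  renaming (_≟_ to _≟ℕ_)
open import Data.Bool using (Bool; true; false; T; _∧_; if_then_else_)
open import Data.Bool.Properties using (T-≡; T-∧; T-∨; ⇔→≡)
open import Data.Fin using (Fin; zero; suc; toℕ; fromℕ<; splitAt; _↑ˡ_; _↑ʳ_; _≟_; inject₁; opposite)
open import Data.Fin.Properties
  using (toℕ-injective; toℕ-fromℕ<; toℕ-inject₁; toℕ<n; splitAt-↑ˡ; splitAt-↑ʳ; splitAt⁻¹-↑ˡ; splitAt⁻¹-↑ʳ;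
         ↑ˡ-injective; opposite-prop; opposite-involutive)
open import Data.Sum using (_⊎_; inj₁; inj₂; [_,_]′)
import Data.Sum as Sum
open import Data.Sum.Function.Propositional using (_⊎-⇔_)
open import Data.Product using (Σ; ∃; _×_; _,_; proj₂)
open import Data.Empty using (⊥-elim)
open import Function using (_∘_; _⇔_; mk⇔; Equivalence)
import Function.Properties.Equivalence as ⇔
open import Relation.Nullary using (¬_; yes; no; contradiction)
open import Relation.Nullary.Decidable using (⌊_⌋; toWitness)
open import Relation.Binary.PropositionalEquality

open Equivalence using (to; from)

absurd⇔ : ∀ {a b} {A : Set a} {B : Set b} → ¬ A → ¬ B → A ⇔ B
absurd⇔ ¬a ¬b = mk⇔ (⊥-elim ∘ ¬a) (⊥-elim ∘ ¬b)

mkSimple-adj⇔ : ∀ {n} (R : Fin n → Fin n → Bool) (x y : Fin n) →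
                adj (mkSimple R) x y ≡ true ⇔ (x ≢ y × (T (R x y) ⊎ T (R y x)))
mkSimple-adj⇔ R x y with x ≟ y
... | yes refl = mk⇔ (λ ()) (λ (x≢x , _) → contradiction refl x≢x)
... | no x≢y   = mk⇔ (λ h → x≢y , to T-∨ (from T-≡ h)) (λ (_ , h) → to T-≡ (from T-∨ h))

adj⇒≢ : ∀ {n} (G : Graph n) {u v} → adj G u v ≡ true → u ≢ v
adj⇒≢ G {u} h refl = contradiction (trans (sym h) (adj-irr G u)) λ ()

AtMostOneNeighbour : ∀ {n} → Graph n → Fin n → Set
AtMostOneNeighbour G v = ∀ {z z'} → adj G v z ≡ true → adj G v z' ≡ true → z ≡ z'

CopyRootedAtLeaf : (Ĥ : TwoRooted) {n : ℕ} → Graph n → Set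
CopyRootedAtLeaf Ĥ G = Σ (Copy Ĥ G) λ c → AtMostOneNeighbour G (copyS c)

module _ {Ĥ : TwoRooted} {n : ℕ} {G : Graph n} (c : Copy Ĥ G) where

  s'-adj⇔ : (E : Extension G (emb c) (copyS c) (copyT c)) (y : Fin (size Ĥ)) →
            adj G (Extension.s' E) (emb c y) ≡ true ⇔ y ≡ sRoot Ĥ
  s'-adj⇔ E y = mk⇔ (λ h → emb-inj c (Extension.s'-nbr E y h)) (λ { refl → Extension.s'-s E })

  t'-adj⇔ : (E : Extension G (emb c) (copyS c) (copyT c)) (y : Fin (size Ĥ)) →
            adj G (Extension.t' E) (emb c y) ≡ true ⇔ y ≡ tRoot Ĥ
  t'-adj⇔ E y = mk⇔ (λ h → emb-inj c (Extension.t'-nbr E y h)) (λ { refl → Extension.t'-t E })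

  -- s' is a neighbour of the s-root outside the copy, and so is t' ≢ s' when the roots coincide.
  leafRooted⇒simplicial : (sRoot Ĥ ≡ tRoot Ĥ ⊎ ∃ λ x → adj (graph Ĥ) (sRoot Ĥ) x ≡ true) →
                          AtMostOneNeighbour G (copyS c) → Simplicial G c
  leafRooted⇒simplicial (inj₁ s≡t) unique E =
    s'≢t' (unique (adjacent-to-root s'-s)
                  (adjacent-to-root (subst (λ v → adj G t' (emb c v) ≡ true) (sym s≡t) t'-t)))
    where
    open Extension E
    adjacent-to-root : ∀ {v} → adj G v (copyS c) ≡ true → adj G (copyS c) v ≡ true
    adjacent-to-root {v} = trans (adj-sym G (copyS c) v)
  leafRooted⇒simplicial (inj₂ (x , sRoot~x)) unique E =
    s'∉ x (unique (trans (emb-adj c (sRoot Ĥ) x) sRoot~x) (trans (adj-sym G (copyS c) s') s'-s))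
    where open Extension E

record RootSwap (Ĥ : TwoRooted) : Set where
  field
    σ       : Fin (size Ĥ) → Fin (size Ĥ)
    σ-inj   : ∀ {x y} → σ x ≡ σ y → x ≡ y
    σ-adj   : ∀ x y → adj (graph Ĥ) (σ x) (σ y) ≡ adj (graph Ĥ) x y
    σ-sRoot : σ (sRoot Ĥ) ≡ tRoot Ĥ
    σ-tRoot : σ (tRoot Ĥ) ≡ sRoot Ĥ

identitySwap : ∀ {Ĥ} → sRoot Ĥ ≡ tRoot Ĥ → RootSwap Ĥ
identitySwap s≡t = record
  { σ = λ x → x ; σ-inj = λ e → e ; σ-adj = λ _ _ → refl ; σ-sRoot = s≡t ; σ-tRoot = sym s≡t }

module _ {Ĥ : TwoRooted} (swap : RootSwap Ĥ) {n : ℕ} {G : Graph n} where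
  open RootSwap swap

  swapCopy : Copy Ĥ G → Copy Ĥ G
  swapCopy c = record
    { emb = emb c ∘ σ
    ; emb-inj = σ-inj ∘ emb-inj c
    ; emb-adj = λ x y → trans (emb-adj c (σ x) (σ y)) (σ-adj x y)
    }

  swapExtension : (c : Copy Ĥ G) → Extension G (emb c) (copyS c) (copyT c) →
                  Extension G (emb (swapCopy c)) (copyS (swapCopy c)) (copyT (swapCopy c))
  swapExtension c E = record
    { s' = t' ; t' = s'
    ; s'≢t' = s'≢t' ∘ sym
    ; s'∉ = t'∉ ∘ σ
    ; t'∉ = s'∉ ∘ σ
    ; s'-nbr = λ x h → trans (t'-nbr (σ x) h) (cong (emb c) (sym σ-sRoot))
    ; s'-s = subst (λ v → adj G t' (emb c v) ≡ true) (sym σ-sRoot) t'-t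
    ; t'-nbr = λ x h → trans (s'-nbr (σ x) h) (cong (emb c) (sym σ-tRoot))
    ; t'-t = subst (λ v → adj G s' (emb c v) ≡ true) (sym σ-tRoot) s'-s
    ; s't' = trans (adj-sym G t' s') s't'
    }
    where open Extension E

data OldOrNew (n m : ℕ) (x : Fin (n + m)) : Set where
  old : (u : Fin n) → x ≡ u ↑ˡ m → OldOrNew n m x
  new : (j : Fin m) → x ≡ n ↑ʳ j → OldOrNew n m x

oldOrNew : ∀ n m (x : Fin (n + m)) → OldOrNew n m x
oldOrNew n m x with splitAt n x in eq
... | inj₁ u = old u (sym (splitAt⁻¹-↑ˡ eq))
... | inj₂ j = new j (sym (splitAt⁻¹-↑ʳ eq))

module PendantExtension {n : ℕ} (G : Graph n) (s t : Fin n) (a b : ℕ) where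

  private
    m : ℕ
    m = a + b
    G' : Graph (n + m)
    G' = addPendants G s t a b

  attachment : Fin m → Fin n
  attachment j = if toℕ j <ᵇ a then s else t

  private
    R : Fin (n + m) → Fin (n + m) → Bool
    R = pendRel G s t a b

    R-old-old : ∀ u v → R (u ↑ˡ m) (v ↑ˡ m) ≡ adj G u v
    R-old-old u v rewrite splitAt-↑ˡ n u m | splitAt-↑ˡ n v m = refl

    R-new-old : ∀ j v → R (n ↑ʳ j) (v ↑ˡ m) ≡ (if toℕ j <ᵇ a then ⌊ v ≟ s ⌋ else ⌊ v ≟ t ⌋)
    R-new-old j v rewrite splitAt-↑ʳ n m j | splitAt-↑ˡ n v m = refl

    R-old-new : ∀ v j → R (v ↑ˡ m) (n ↑ʳ j) ≡ false
    R-old-new v j rewrite splitAt-↑ʳ n m j | splitAt-↑ˡ n v m = refl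

    R-new-new : ∀ i j → R (n ↑ʳ i) (n ↑ʳ j) ≡ false
    R-new-new i j rewrite splitAt-↑ʳ n m i | splitAt-↑ʳ n m j = refl

    attached : ∀ j v → T (if toℕ j <ᵇ a then ⌊ v ≟ s ⌋ else ⌊ v ≟ t ⌋) → v ≡ attachment j
    attached j v with toℕ j <ᵇ a
    ... | true  = toWitness
    ... | false = toWitness

  adj-old : ∀ u v → adj G' (u ↑ˡ m) (v ↑ˡ m) ≡ adj G u v
  adj-old u v = ⇔→≡ (⇔.trans (mkSimple-adj⇔ R (u ↑ˡ m) (v ↑ˡ m)) (mk⇔ to′ from′))
    where
    to′ : u ↑ˡ m ≢ v ↑ˡ m × (T (R (u ↑ˡ m) (v ↑ˡ m)) ⊎ T (R (v ↑ˡ m) (u ↑ˡ m))) → adj G u v ≡ true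
    to′ (_ , inj₁ h) = to T-≡ (subst T (R-old-old u v) h)
    to′ (_ , inj₂ h) = trans (adj-sym G u v) (to T-≡ (subst T (R-old-old v u) h))
    from′ : adj G u v ≡ true → u ↑ˡ m ≢ v ↑ˡ m × (T (R (u ↑ˡ m) (v ↑ˡ m)) ⊎ T (R (v ↑ˡ m) (u ↑ˡ m)))
    from′ h = adj⇒≢ G h ∘ ↑ˡ-injective m u v , inj₁ (subst T (sym (R-old-old u v)) (from T-≡ h))

  adj-new : ∀ j y → adj G' (n ↑ʳ j) y ≡ true → y ≡ attachment j ↑ˡ m
  adj-new j y h with oldOrNew n m y | proj₂ (to (mkSimple-adj⇔ R _ _) h)
  ... | old v refl | inj₁ h′ = cong (_↑ˡ m) (attached j v (subst T (R-new-old j v) h′))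
  ... | old v refl | inj₂ h′ = ⊥-elim (subst T (R-old-new v j) h′)
  ... | new i refl | inj₁ h′ = ⊥-elim (subst T (R-new-new j i) h′)
  ... | new i refl | inj₂ h′ = ⊥-elim (subst T (R-new-new i j) h′)

  new-atMostOneNeighbour : ∀ j → AtMostOneNeighbour G' (n ↑ʳ j)
  new-atMostOneNeighbour j h h′ = trans (adj-new j _ h) (sym (adj-new j _ h′))

  attachment-cases : ∀ j → attachment j ≡ s ⊎ attachment j ≡ t
  attachment-cases j with toℕ j <ᵇ a
  ... | true  = inj₁ refl
  ... | false = inj₂ refl

  old-neighbour : ∀ {v} → v ≢ s → v ≢ t → ∀ z → adj G' (v ↑ˡ m) z ≡ true →
                  Σ (Fin n) λ u → z ≡ u ↑ˡ m × adj G v u ≡ true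
  old-neighbour {v} v≢s v≢t z h with oldOrNew n m z
  ... | old u refl = u , refl , trans (sym (adj-old v u)) h
  ... | new j refl = ⊥-elim ([ v≢s ∘ trans v≡att , v≢t ∘ trans v≡att ]′ (attachment-cases j))
    where
    v≡att : v ≡ attachment j
    v≡att = ↑ˡ-injective m v _ (adj-new j (v ↑ˡ m) (trans (adj-sym G' _ _) h))

  old-atMostOneNeighbour : ∀ {v} → v ≢ s → v ≢ t → AtMostOneNeighbour G v → AtMostOneNeighbour G' (v ↑ˡ m)
  old-atMostOneNeighbour v≢s v≢t unique {z} {z′} h h′
    with old-neighbour v≢s v≢t z h | old-neighbour v≢s v≢t z′ h′
  ... | u , refl , v~u | u′ , refl , v~u′ = cong (_↑ˡ m) (unique v~u v~u′)

  liftCopy : ∀ {Ĥ} → Copy Ĥ G → Copy Ĥ G'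
  liftCopy c = record
    { emb = λ x → lift m (emb c x)
    ; emb-inj = emb-inj c ∘ ↑ˡ-injective m _ _
    ; emb-adj = λ x y → trans (adj-old (emb c x) (emb c y)) (emb-adj c x y)
    }

  restrictExtension : ∀ {k} {f : Fin k → Fin n} {s₀ t₀ : Fin n} →
                      (E : Extension G' (λ x → lift m (f x)) (lift m s₀) (lift m t₀)) →
                      ∀ {u v : Fin n} → Extension.s' E ≡ u ↑ˡ m → Extension.t' E ≡ v ↑ˡ m →
                      Extension G f s₀ t₀
  restrictExtension {f = f} {s₀} {t₀} E {u} {v} s'≡u t'≡v = record
    { s' = u ; t' = v
    ; s'≢t' = λ u≡v → s'≢t' (trans s'≡u (trans (cong (_↑ˡ m) u≡v) (sym t'≡v)))
    ; s'∉ = λ x fx≡u → s'∉ x (trans (cong (_↑ˡ m) fx≡u) (sym s'≡u))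
    ; t'∉ = λ x fx≡v → t'∉ x (trans (cong (_↑ˡ m) fx≡v) (sym t'≡v))
    ; s'-nbr = λ x h → ↑ˡ-injective m _ _ (s'-nbr x (trans (from-s' (f x)) h))
    ; s'-s = trans (sym (from-s' s₀)) s'-s
    ; t'-nbr = λ x h → ↑ˡ-injective m _ _ (t'-nbr x (trans (from-t' (f x)) h))
    ; t'-t = trans (sym (from-t' t₀)) t'-t
    ; s't' = trans (sym (from-s' v)) (trans (cong (adj G' s') (sym t'≡v)) s't')
    }
    where
    open Extension E
    from-s' : ∀ w → adj G' s' (w ↑ˡ m) ≡ adj G u w
    from-s' w = trans (cong (λ z → adj G' z (w ↑ˡ m)) s'≡u) (adj-old u w)
    from-t' : ∀ w → adj G' t' (w ↑ˡ m) ≡ adj G v w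
    from-t' w = trans (cong (λ z → adj G' z (w ↑ˡ m)) t'≡v) (adj-old v w)

module Comb (k q r : ℕ) where

  p L S : ℕ
  p = suc k
  L = p + q + r
  S = combSize p q r

  comb : TwoRooted
  comb = T₁ p q r (s≤s z≤n)

  data Edge (m n : ℕ) : Set where
    spine : m < L → n < L → suc m ≡ n → Edge m n
    tooth : L ≤ m → n < L → n + L ≡ m + p → Edge m n

  Adjacent : ℕ → ℕ → Set
  Adjacent m n = Edge m n ⊎ Edge n m

  combRel⇔Edge : ∀ m n → T (combRel p q r m n) ⇔ Edge m n
  combRel⇔Edge m n = mk⇔ ([ spine-sound , tooth-sound ]′ ∘ to T-∨) complete
    where
    spine-sound : T ((m <ᵇ L) ∧ (n <ᵇ L) ∧ (suc m ≡ᵇ n)) → Edge m n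
    spine-sound h with to (T-∧ {m <ᵇ L}) h
    ... | m<L , h′ with to (T-∧ {n <ᵇ L}) h′
    ... | n<L , 1+m≡n = spine (<ᵇ⇒< m L m<L) (<ᵇ⇒< n L n<L) (≡ᵇ⇒≡ (suc m) n 1+m≡n)
    tooth-sound : T ((L ≤ᵇ m) ∧ (n <ᵇ L) ∧ ((n + L) ≡ᵇ (m + p))) → Edge m n
    tooth-sound h with to (T-∧ {L ≤ᵇ m}) h
    ... | L≤m , h′ with to (T-∧ {n <ᵇ L}) h′
    ... | n<L , e = tooth (≤ᵇ⇒≤ L m L≤m) (<ᵇ⇒< n L n<L) (≡ᵇ⇒≡ (n + L) (m + p) e)
    complete : Edge m n → T (combRel p q r m n)
    complete (spine m<L n<L e) =
      from T-∨ (inj₁ (from T-∧ (<⇒<ᵇ m<L , from T-∧ (<⇒<ᵇ n<L , ≡⇒≡ᵇ (suc m) n e))))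
    complete (tooth L≤m n<L e) =
      from T-∨ (inj₂ (from T-∧ (≤⇒≤ᵇ L≤m , from T-∧ (<⇒<ᵇ n<L , ≡⇒≡ᵇ (n + L) (m + p) e))))

  Adjacent-comm : ∀ {m n} → Adjacent m n ⇔ Adjacent n m
  Adjacent-comm = mk⇔ Sum.swap Sum.swap

  Adjacent-irrefl : ∀ {m} → ¬ Adjacent m m
  Adjacent-irrefl = [ irrefl , irrefl ]′
    where
    irrefl : ∀ {m} → ¬ Edge m m
    irrefl (spine _ _ e)   = 1+n≢n e
    irrefl (tooth L≤m m<L _) = <⇒≱ m<L L≤m

  F-adj⇔ : ∀ x y → adj (F p q r) x y ≡ true ⇔ Adjacent (toℕ x) (toℕ y)
  F-adj⇔ x y = ⇔.trans (mkSimple-adj⇔ (λ u v → combRel p q r (toℕ u) (toℕ v)) x y)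
                       (mk⇔ (to edges⇔ ∘ proj₂) (λ a → (λ { refl → Adjacent-irrefl a }) , from edges⇔ a))
    where
    edges⇔ : (T (combRel p q r (toℕ x) (toℕ y)) ⊎ T (combRel p q r (toℕ y) (toℕ x))) ⇔ Adjacent (toℕ x) (toℕ y)
    edges⇔ = combRel⇔Edge _ _ ⊎-⇔ combRel⇔Edge _ _

  Adjacent-spine : ∀ {i} → suc i < L → Adjacent i (suc i)
  Adjacent-spine 1+i<L = inj₁ (spine (<-trans (n<1+n _) 1+i<L) 1+i<L refl)

  Adjacent-spineOnly : ∀ {m n} → m < L → n < L → Adjacent m n ⇔ (suc m ≡ n ⊎ suc n ≡ m)
  Adjacent-spineOnly m<L n<L = mk⇔ (Sum.map (onSpine m<L) (onSpine n<L))
                                   (Sum.map (spine m<L n<L) (spine n<L m<L))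
    where
    onSpine : ∀ {m n} → m < L → Edge m n → suc m ≡ n
    onSpine _   (spine _ _ e)     = e
    onSpine m<L (tooth L≤m _ _)   = contradiction L≤m (<⇒≱ m<L)

  ¬Adjacent-0-L : ¬ Adjacent 0 L
  ¬Adjacent-0-L (inj₁ (spine _ L<L _)) = <-irrefl refl L<L
  ¬Adjacent-0-L (inj₂ (tooth _ _ e))   = m+1+n≢m L (sym e)

  Adjacent-0-suc : ∀ {m} → suc m ≢ L → Adjacent 0 (suc m) ⇔ m ≡ 0
  Adjacent-0-suc {m} 1+m≢L = mk⇔ to′ λ { refl → Adjacent-spine (≤∧≢⇒< (s≤s z≤n) 1+m≢L) }
    where
    to′ : Adjacent 0 (suc m) → m ≡ 0
    to′ (inj₁ (spine _ _ e))     = sym (suc-injective e)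
    to′ (inj₂ (tooth L≤1+m _ e)) = contradiction (subst (_≤ suc m) e L≤1+m) (m+1+n≰m (suc m))

  Adjacent-L : p < L → ∀ {n} → Adjacent L n ⇔ n ≡ p
  Adjacent-L p<L {n} = mk⇔ to′ λ { refl → inj₁ (tooth ≤-refl p<L (+-comm p L)) }
    where
    to′ : Adjacent L n → n ≡ p
    to′ (inj₁ (spine L<L _ _))   = contradiction L<L (<-irrefl refl)
    to′ (inj₁ (tooth _ _ e))     = +-cancelʳ-≡ L n p (trans e (+-comm L p))
    to′ (inj₂ (spine _ L<L _))   = contradiction L<L (<-irrefl refl)
    to′ (inj₂ (tooth _ L<L _))   = contradiction L<L (<-irrefl refl)

  Adjacent-suc : ∀ {m n} → suc m ≢ L → suc n ≢ L → Adjacent (suc m) (suc n) ⇔ Adjacent m n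
  Adjacent-suc 1+m≢L 1+n≢L = mk⇔ (Sum.map (pred-edge 1+m≢L) (pred-edge 1+n≢L))
                                 (Sum.map (suc-edge 1+m≢L 1+n≢L) (suc-edge 1+n≢L 1+m≢L))
    where
    pred-edge : ∀ {m n} → suc m ≢ L → Edge (suc m) (suc n) → Edge m n
    pred-edge _     (spine 1+m<L 1+n<L e) = spine (<-trans (n<1+n _) 1+m<L) (<-trans (n<1+n _) 1+n<L) (suc-injective e)
    pred-edge 1+m≢L (tooth L≤1+m 1+n<L e) =
      tooth (≤-pred (≤∧≢⇒< L≤1+m (1+m≢L ∘ sym))) (<-trans (n<1+n _) 1+n<L) (suc-injective e)
    suc-edge : ∀ {m n} → suc m ≢ L → suc n ≢ L → Edge m n → Edge (suc m) (suc n)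
    suc-edge 1+m≢L 1+n≢L (spine m<L n<L e) = spine (≤∧≢⇒< m<L 1+m≢L) (≤∧≢⇒< n<L 1+n≢L) (cong suc e)
    suc-edge _     1+n≢L (tooth L≤m n<L e) = tooth (m≤n⇒m≤1+n L≤m) (≤∧≢⇒< n<L 1+n≢L) (cong suc e)

  Adjacent-0 : ∀ {n} → Adjacent 0 n → n ≡ 1
  Adjacent-0 {zero} a = contradiction a Adjacent-irrefl
  Adjacent-0 {suc m} a with suc m ≟ℕ L
  ... | yes refl   = contradiction a ¬Adjacent-0-L
  ... | no 1+m≢L   = cong suc (to (Adjacent-0-suc 1+m≢L) a)

  toℕ-tRoot : toℕ (tRoot comb) ≡ k
  toℕ-tRoot = toℕ-fromℕ< _

  module _ {n : ℕ} {G : Graph n} where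

    copy-adj⇔ : (c : Copy comb G) (x y : Fin S) → adj G (emb c x) (emb c y) ≡ true ⇔ Adjacent (toℕ x) (toℕ y)
    copy-adj⇔ c x y = subst (λ b → b ≡ true ⇔ Adjacent (toℕ x) (toℕ y)) (sym (emb-adj c x y)) (F-adj⇔ x y)

    combCopy : (f : Fin S → Fin n) → (∀ {x y} → f x ≡ f y → x ≡ y) →
               (∀ x y → adj G (f x) (f y) ≡ true ⇔ Adjacent (toℕ x) (toℕ y)) → Copy comb G
    combCopy f f-inj f-adj = record
      { emb = f ; emb-inj = f-inj ; emb-adj = λ x y → ⇔→≡ (⇔.trans (f-adj x y) (⇔.sym (F-adj⇔ x y))) }

  spineVertex : ∀ i → i < L → Fin S
  spineVertex i i<L = fromℕ< (<-≤-trans i<L (m≤m+n L q))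

  toℕ-spineVertex : ∀ i (i<L : i < L) → toℕ (spineVertex i i<L) ≡ i
  toℕ-spineVertex i i<L = toℕ-fromℕ< _

  interior-notLeaf : ∀ {n} {G : Graph n} (c : Copy comb G) (x : Fin S) {i} →
                     toℕ x ≡ suc i → suc (suc i) < L → ¬ AtMostOneNeighbour G (emb c x)
  interior-notLeaf {G = G} c x {i} x≡1+i 2+i<L unique =
    <⇒≢ (<-trans (n<1+n i) (n<1+n (suc i)))
        (trans (sym (toℕ-spineVertex _ i<L))
               (trans (cong toℕ (emb-inj c (unique x~before x~after))) (toℕ-spineVertex _ 2+i<L)))
    where
    i<L : i < L
    i<L = <-trans (n<1+n i) (<-trans (n<1+n (suc i)) 2+i<L)
    x~before : adj G (emb c x) (emb c (spineVertex i i<L)) ≡ true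
    x~before = from (copy-adj⇔ c x _) (subst₂ Adjacent (sym x≡1+i) (sym (toℕ-spineVertex _ i<L))
                                              (to Adjacent-comm (Adjacent-spine (<-trans (n<1+n (suc i)) 2+i<L))))
    x~after : adj G (emb c x) (emb c (spineVertex (suc (suc i)) 2+i<L)) ≡ true
    x~after = from (copy-adj⇔ c x _) (subst₂ Adjacent (sym x≡1+i) (sym (toℕ-spineVertex _ 2+i<L)) (Adjacent-spine 2+i<L))

  data ShiftView (x : Fin S) : Set where
    first      : toℕ x ≡ 0 → ShiftView x
    firstTooth : toℕ x ≡ L → ShiftView x
    successor  : (y : Fin S) → toℕ x ≡ suc (toℕ y) → toℕ x ≢ L → ShiftView x

  shiftView : (x : Fin S) → ShiftView x
  shiftView zero = first refl
  shiftView (suc y) with suc (toℕ y) ≟ℕ L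
  ... | yes 1+y≡L = firstTooth 1+y≡L
  ... | no 1+y≢L  = successor (inject₁ y) (cong suc (sym (toℕ-inject₁ y))) 1+y≢L

  firstTooth⇒p<L : ∀ {x : Fin S} → toℕ x ≡ L → p < L
  firstTooth⇒p<L {x} x≡L = <-≤-trans (m<m+n p 0<q) (m≤m+n (p + q) r)
    where
    0<q : 0 < q
    0<q = +-cancelˡ-< L 0 q (subst (_< L + q) (trans x≡L (sym (+-identityʳ L))) (toℕ<n x))

  -- The comb slid by one step: s' becomes a₁, t' becomes the first tooth, and every other
  -- vertex goes to the image under c of its predecessor in the numbering.
  module Shift {n : ℕ} {G : Graph n} (c : Copy comb G) (E : Extension G (emb c) (copyS c) (copyT c)) where
    open Extension E

    shiftAt : ∀ {x} → ShiftView x → Fin n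
    shiftAt (first _)         = s'
    shiftAt (firstTooth _)    = t'
    shiftAt (successor y _ _) = emb c y

    private
      reindex : ∀ {u v m n m′ n′} → m ≡ m′ → n ≡ n′ →
                adj G u v ≡ true ⇔ Adjacent m′ n′ → adj G u v ≡ true ⇔ Adjacent m n
      reindex refl refl h = h

      loop : ∀ {v m} → adj G v v ≡ true ⇔ Adjacent m m
      loop = absurd⇔ (λ h → adj⇒≢ G h refl) Adjacent-irrefl

      flipped : ∀ {u v m n} → adj G v u ≡ true ⇔ Adjacent n m → adj G u v ≡ true ⇔ Adjacent m n
      flipped {u} {v} h = ⇔.trans (mk⇔ (trans (adj-sym G v u)) (trans (adj-sym G u v))) (⇔.trans h Adjacent-comm)

      s'-t' : adj G s' t' ≡ true ⇔ Adjacent 0 L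
      s'-t' = absurd⇔ (λ h → contradiction (trans (sym h) s't') λ ()) ¬Adjacent-0-L

      s'-successor : ∀ y → suc (toℕ y) ≢ L → adj G s' (emb c y) ≡ true ⇔ Adjacent 0 (suc (toℕ y))
      s'-successor y 1+y≢L = ⇔.trans (s'-adj⇔ c E y)
        (⇔.trans (mk⇔ (cong toℕ) toℕ-injective) (⇔.sym (Adjacent-0-suc 1+y≢L)))

      t'-successor : p < L → ∀ y → adj G t' (emb c y) ≡ true ⇔ Adjacent L (suc (toℕ y))
      t'-successor p<L y = ⇔.trans (t'-adj⇔ c E y)
        (⇔.trans (mk⇔ (λ e → cong suc (trans (cong toℕ e) toℕ-tRoot))
                      (λ e → toℕ-injective (trans (suc-injective e) (sym toℕ-tRoot))))
                 (⇔.sym (Adjacent-L p<L)))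

      successor-successor : ∀ x y → suc (toℕ x) ≢ L → suc (toℕ y) ≢ L →
                            adj G (emb c x) (emb c y) ≡ true ⇔ Adjacent (suc (toℕ x)) (suc (toℕ y))
      successor-successor x y 1+x≢L 1+y≢L = ⇔.trans (copy-adj⇔ c x y) (⇔.sym (Adjacent-suc 1+x≢L 1+y≢L))

    shiftAt-adj⇔ : ∀ {x y} (vx : ShiftView x) (vy : ShiftView y) →
                   adj G (shiftAt vx) (shiftAt vy) ≡ true ⇔ Adjacent (toℕ x) (toℕ y)
    shiftAt-adj⇔ (first x≡0)        (first y≡0)          = reindex x≡0 y≡0 loop
    shiftAt-adj⇔ (first x≡0)        (firstTooth y≡L)     = reindex x≡0 y≡L s'-t'
    shiftAt-adj⇔ (first x≡0)        (successor y e y≢L)  = reindex x≡0 e (s'-successor y (y≢L ∘ trans e))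
    shiftAt-adj⇔ (firstTooth x≡L)   (first y≡0)          = reindex x≡L y≡0 (flipped s'-t')
    shiftAt-adj⇔ (firstTooth x≡L)   (firstTooth y≡L)     = reindex x≡L y≡L loop
    shiftAt-adj⇔ (firstTooth x≡L)   (successor y e _)    = reindex x≡L e (t'-successor (firstTooth⇒p<L x≡L) y)
    shiftAt-adj⇔ (successor x e x≢L) (first y≡0)         = reindex e y≡0 (flipped (s'-successor x (x≢L ∘ trans e)))
    shiftAt-adj⇔ (successor x e _)  (firstTooth y≡L)     = reindex e y≡L (flipped (t'-successor (firstTooth⇒p<L y≡L) x))
    shiftAt-adj⇔ (successor x e x≢L) (successor y e′ y≢L) =
      reindex e e′ (successor-successor x y (x≢L ∘ trans e) (y≢L ∘ trans e′))

    shiftAt-inj : ∀ {x y} (vx : ShiftView x) (vy : ShiftView y) → shiftAt vx ≡ shiftAt vy → x ≡ y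
    shiftAt-inj (first x≡0)       (first y≡0)         _ = toℕ-injective (trans x≡0 (sym y≡0))
    shiftAt-inj (first _)         (firstTooth _)      h = ⊥-elim (s'≢t' h)
    shiftAt-inj (first _)         (successor y _ _)   h = ⊥-elim (s'∉ y (sym h))
    shiftAt-inj (firstTooth _)    (first _)           h = ⊥-elim (s'≢t' (sym h))
    shiftAt-inj (firstTooth x≡L)  (firstTooth y≡L)    _ = toℕ-injective (trans x≡L (sym y≡L))
    shiftAt-inj (firstTooth _)    (successor y _ _)   h = ⊥-elim (t'∉ y (sym h))
    shiftAt-inj (successor x _ _) (first _)           h = ⊥-elim (s'∉ x h)
    shiftAt-inj (successor x _ _) (firstTooth _)      h = ⊥-elim (t'∉ x h)
    shiftAt-inj (successor x e _) (successor y e′ _)  h =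
      toℕ-injective (trans e (trans (cong (suc ∘ toℕ) (emb-inj c h)) (sym e′)))

    shiftCopy : Copy comb G
    shiftCopy = combCopy (λ x → shiftAt (shiftView x))
                         (λ {x} {y} → shiftAt-inj (shiftView x) (shiftView y))
                         (λ x y → shiftAt-adj⇔ (shiftView x) (shiftView y))

mirror-suc⇔ : ∀ {m m′ n n′} → suc m + m′ ≡ suc n + n′ → (suc m′ ≡ n′ ⇔ suc n ≡ m)
mirror-suc⇔ {m} {m′} {n} {n′} e = mk⇔ to′ from′
  where
  to′ : suc m′ ≡ n′ → suc n ≡ m
  to′ refl = sym (+-cancelʳ-≡ m′ m (suc n) (suc-injective (trans e (+-suc (suc n) m′))))
  from′ : suc n ≡ m → suc m′ ≡ n′
  from′ refl = +-cancelˡ-≡ (suc n) (suc m′) n′ (trans (+-suc (suc n) m′) e)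

module _ (k : ℕ) where
  open Comb k 0 0

  reversal : RootSwap comb
  reversal = record
    { σ = opposite
    ; σ-inj = λ {x} {y} e → trans (sym (opposite-involutive x)) (trans (cong opposite e) (opposite-involutive y))
    ; σ-adj = λ x y → ⇔→≡ (⇔.trans (F-adj⇔ (opposite x) (opposite y))
                                   (⇔.trans (mirrored x y) (⇔.sym (F-adj⇔ x y))))
    ; σ-sRoot = opposite-sRoot
    ; σ-tRoot = trans (cong opposite (sym opposite-sRoot)) (opposite-involutive zero)
    }
    where
    mirror : ∀ x → suc (toℕ x) + toℕ (opposite x) ≡ S
    mirror x = trans (cong (suc (toℕ x) +_) (opposite-prop x)) (m+[n∸m]≡n (toℕ<n x))

    onSpine : ∀ x → toℕ x < L
    onSpine x = subst (toℕ x <_) (+-identityʳ L) (toℕ<n x)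

    mirrored : ∀ x y → Adjacent (toℕ (opposite x)) (toℕ (opposite y)) ⇔ Adjacent (toℕ x) (toℕ y)
    mirrored x y =
      ⇔.trans (Adjacent-spineOnly (onSpine (opposite x)) (onSpine (opposite y)))
      (⇔.trans (mirror-suc⇔ x+x′≡y+y′ ⊎-⇔ mirror-suc⇔ (sym x+x′≡y+y′))
      (⇔.trans (mk⇔ Sum.swap Sum.swap) (⇔.sym (Adjacent-spineOnly (onSpine x) (onSpine y)))))
      where
      x+x′≡y+y′ : suc (toℕ x) + toℕ (opposite x) ≡ suc (toℕ y) + toℕ (opposite y)
      x+x′≡y+y′ = trans (mirror x) (sym (mirror y))

    opposite-sRoot : opposite zero ≡ tRoot comb
    opposite-sRoot = toℕ-injective (trans (opposite-prop zero)
      (trans (trans (+-identityʳ (k + 0 + 0)) (trans (+-identityʳ (k + 0)) (+-identityʳ k))) (sym toℕ-tRoot)))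

comb-sRoot≡tRoot⊎adjacent : ∀ k q r → let open Comb k q r in
                            sRoot comb ≡ tRoot comb ⊎ ∃ λ x → adj (graph comb) (sRoot comb) x ≡ true
comb-sRoot≡tRoot⊎adjacent zero    q r = inj₁ refl
comb-sRoot≡tRoot⊎adjacent (suc k) q r =
  inj₂ (suc zero , from (F-adj⇔ zero (suc zero)) (Adjacent-spine (s≤s (s≤s z≤n))))
  where open Comb (suc k) q r

comb-tRoot-branching : ∀ k q r → let open Comb (suc k) q r in
  p < L → 1 < L × ∀ {n} {G : Graph n} (c : Copy comb G) → ¬ AtMostOneNeighbour G (copyT c)
comb-tRoot-branching k q r p<L = <-trans (s≤s (s≤s z≤n)) p<L , λ c → interior-notLeaf c (tRoot comb) toℕ-tRoot p<L
  where open Comb (suc k) q r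

-- When p = 1 the roots coincide, and when q = r = 0 the comb is a path; otherwise a_p lies
-- strictly inside the spine.
rootSwap⊎branchingTRoot : ∀ k q r → let open Comb k q r in
  RootSwap comb ⊎ (1 < L × ∀ {n} {G : Graph n} (c : Copy comb G) → ¬ AtMostOneNeighbour G (copyT c))
rootSwap⊎branchingTRoot zero    q         r         = inj₁ (identitySwap refl)
rootSwap⊎branchingTRoot (suc k) zero      zero      = inj₁ (reversal (suc k))
rootSwap⊎branchingTRoot (suc k) q@(suc _) r         =
  inj₂ (comb-tRoot-branching k q r (<-≤-trans (m<m+n _ (s≤s z≤n)) (m≤m+n _ r)))
rootSwap⊎branchingTRoot (suc k) zero      r@(suc _) =
  inj₂ (comb-tRoot-branching k 0 r (subst (_< suc (suc k) + 0 + r) (+-identityʳ _) (m<m+n _ (s≤s z≤n))))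

module _ (k q r : ℕ) where
  open Comb k q r

  initialCopy : CopyRootedAtLeaf comb (graph comb)
  initialCopy = record { emb = λ x → x ; emb-inj = λ e → e ; emb-adj = λ _ _ → refl }
              , λ {z} {z′} h h′ → toℕ-injective (trans (Adjacent-0 (to (F-adj⇔ zero z) h))
                                                       (sym (Adjacent-0 (to (F-adj⇔ zero z′) h′))))

  module _ {n : ℕ} {G : Graph n} (c : Copy comb G) (a b : ℕ) where
    open PendantExtension G (copyS c) (copyT c) a b

    private
      m : ℕ
      m = a + b
      G' : Graph (n + m)
      G' = addPendants G (copyS c) (copyT c) a b

    leafRootedAtNewVertex : (c′ : Copy comb G') (E : Extension G' (emb c′) (copyS c′) (copyT c′)) →
                            ∀ {j} → Extension.s' E ≡ n ↑ʳ j → CopyRootedAtLeaf comb G'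
    leafRootedAtNewVertex c′ E {j} s'≡j =
      Shift.shiftCopy c′ E , subst (AtMostOneNeighbour G') (sym s'≡j) (new-atMostOneNeighbour j)

    liftLeafRootedCopy : CopyRootedAtLeaf comb G → 1 < L → ¬ AtMostOneNeighbour G (copyT c) →
                         (E : Fixes G c a b) → ∀ {u} → Extension.s' E ≡ u ↑ˡ m → CopyRootedAtLeaf comb G'
    liftLeafRootedCopy (d , unique) 1<L tRoot-notLeaf E {u} s'≡u =
      liftCopy d , old-atMostOneNeighbour d≢sRoot d≢tRoot unique
      where
      open Extension E
      sRoot~second : adj G (copyS c) (emb c (spineVertex 1 1<L)) ≡ true
      sRoot~second = from (copy-adj⇔ c zero _) (subst (Adjacent 0) (sym (toℕ-spineVertex 1 1<L)) (Adjacent-spine 1<L))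
      sRoot~u : adj G (copyS c) u ≡ true
      sRoot~u = trans (adj-sym G (copyS c) u)
                      (trans (sym (adj-old u (copyS c))) (subst (λ w → adj G' w (copyS c ↑ˡ m) ≡ true) s'≡u s'-s))
      d≢sRoot : copyS d ≢ copyS c
      d≢sRoot e = s'∉ (spineVertex 1 1<L)
        (trans (cong (_↑ˡ m) (subst (AtMostOneNeighbour G) e unique sRoot~second sRoot~u)) (sym s'≡u))
      d≢tRoot : copyS d ≢ copyT c
      d≢tRoot e = tRoot-notLeaf (subst (AtMostOneNeighbour G) e unique)

    leafRootedStep : CopyRootedAtLeaf comb G → Simplicial G c → Fixes G c a b → CopyRootedAtLeaf comb G'
    leafRootedStep d simplicial E with oldOrNew n m (Extension.s' E)
    ... | new j s'≡j = leafRootedAtNewVertex (liftCopy c) E s'≡j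
    ... | old u s'≡u with rootSwap⊎branchingTRoot k q r
    ...   | inj₂ (1<L , tRoot-notLeaf) = liftLeafRootedCopy d 1<L (tRoot-notLeaf c) E s'≡u
    ...   | inj₁ swap with oldOrNew n m (Extension.t' E)
    ...     | new j t'≡j = leafRootedAtNewVertex (swapCopy swap (liftCopy c)) (swapExtension swap (liftCopy c) E) t'≡j
    ...     | old v t'≡v = ⊥-elim (simplicial (restrictExtension E s'≡u t'≡v))

  leafRootedAlong : ∀ {n} {G : Graph n} → PESeq comb G → CopyRootedAtLeaf comb G
  leafRootedAlong start = initialCopy
  leafRootedAlong (step seq c simplicial a b (fixes , _)) = leafRootedStep c a b (leafRootedAlong seq) simplicial fixes

proposition3p32 : (p q r : ℕ) → (hp : 1 ≤ p) → PEInherent (T₁ p q r hp)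
proposition3p32 zero    q r ()
proposition3p32 (suc k) q r _ (_ , G , seq , noSimplicialCopy) =
  let (c , sRoot-leaf) = leafRootedAlong k q r seq in
  noSimplicialCopy (c , leafRooted⇒simplicial c (comb-sRoot≡tRoot⊎adjacent k q r) sRoot-leaf)
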